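{- For every integer $n>3$, there are at least two complete games of the Zeckendorf Game on $n$ with different numbers of moves; moreover, there is a complete game with an odd number of moves and a complete game with an even number of moves.
   Context: Fibonacci numbers are indexed as $F_1=1$, $F_2=2$, $F_{i+1}=F_i+F_{i-1}$. The Zeckendorf Game on $n$: the state is an unordered multiset of Fibonacci numbers summing to $n$, initially $n$ copies of $F_1$; a legal move is one of: (1) replace $F_{i-1},F_i$ by $F_{i+1}$; (2a) replace $F_1,F_1$ by $F_2$; (2b) replace $F_2,F_2$ by $F_1,F_3$; (2c) for $i\ge3$, replace $F_i,F_i$ by $F_{i-2},F_{i+1}$. A complete game is a sequence of legal moves from the initial state ending at a state with no legal move (which is the Zeckendorf decomposition of $n$, its unique representation as a sum of distinct non-adjacent Fibonacci numbers). -}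

module Defs where

open import Data.Nat using (ℕ; zero; suc; _+_)
open import Data.List using (List; []; _∷_; _++_; replicate)
open import Data.List.Relation.Binary.Permutation.Propositional using (_↭_)
open import Data.Product using (∃; ∃-syntax; _×_)
open import Relation.Nullary using (¬_)

-- Fibonacci numbers indexed F 1 = 1, F 2 = 2, F (i+1) = F i + F (i-1).
-- (F 0 = 1 is an unused filler value.)
F : ℕ → ℕ
F zero = 1
F (suc zero) = 1
F (suc (suc zero)) = 2
F (suc (suc (suc i))) = F (suc (suc i)) + F (suc i)

-- A state of the game is an unordered multiset of Fibonacci numbers F_i (i ≥ 1),
-- represented by the list of their indices i; lists are considered up to
-- permutation (_↭_), so a state is a multiset.

data Move : List ℕ → List ℕ → Set where
  -- (1) F_{i-1}, F_i  ↦  F_{i+1}   (i ≥ 2, written i = j + 2)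
  combine : ∀ j → Move (suc j ∷ suc (suc j) ∷ []) (suc (suc (suc j)) ∷ [])
  split1  : Move (1 ∷ 1 ∷ []) (2 ∷ [])
  split2  : Move (2 ∷ 2 ∷ []) (1 ∷ 3 ∷ [])
  -- (2c) F_i, F_i ↦ F_{i-2}, F_{i+1}   (i ≥ 3, written i = j + 3)
  splitN  : ∀ j → Move (suc (suc (suc j)) ∷ suc (suc (suc j)) ∷ [])
                       (suc j ∷ suc (suc (suc (suc j))) ∷ [])

Step : List ℕ → List ℕ → Set
Step s t = ∃[ removed ] ∃[ added ] ∃[ rest ]
  (Move removed added × s ↭ removed ++ rest × t ↭ added ++ rest)

Terminal : List ℕ → Set
Terminal s = ∀ t → ¬ Step s t

data Steps : List ℕ → List ℕ → ℕ → Set where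
  done : ∀ {s} → Steps s s 0
  step : ∀ {s t u k} → Step s t → Steps t u k → Steps s u (suc k)

initial : ℕ → List ℕ
initial n = replicate n 1

CompleteGameOfLength : ℕ → ℕ → Set
CompleteGameOfLength n k = ∃[ final ] (Steps (initial n) final k × Terminal final)

module Submission where

-- A list of indices is in Zeckendorf form when it is strictly
-- increasing with gaps of at least two; such a state admits no legal move
-- (no index is repeated and no two indices are consecutive).  Conversely,
-- every multiset of ones can be played out to a Zeckendorf state: absorb the
-- ones one at a time into a Zeckendorf list, using F₁F₁ ↦ F₂ or F₁F₂ ↦ F₃ and
-- then carrying upwards with the moves F_{i-1}F_i ↦ F_{i+1}.
--
-- Hence any opening that turns p ones into a Zeckendorf list Z extends to a
-- complete game on p + m, with the same number k of further moves whatever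
-- the opening.  On four ones there are two openings reaching {F₁, F₃}, with
-- 2 and 3 moves:  1111 → 112 → 13  and  1111 → 112 → 22 → 13.  So for
-- n = 4 + m there are complete games of the consecutive lengths 2 + k and
-- 3 + k; they differ, and one is odd while the other is even.

open import Defs
open import Data.Nat using (ℕ; zero; suc; _+_; _<_; _≤_; _%_; z≤n; s≤s)
open import Data.Nat.Properties
  using (≤-refl; ≤-trans; n≤1+n; m≤n⇒m≤1+n; m≤n⇒m<n∨m≡n; <-irrefl; 1+n≢n;
         +-identityʳ; +-suc)
open import Data.List using (List; []; _∷_; _++_; replicate)
open import Data.List.Membership.Propositional using (_∈_)
open import Data.List.Relation.Unary.All as All using (All; []; _∷_)
open import Data.List.Relation.Unary.AllPairs using ([]; _∷_)
open import Data.List.Relation.Unary.Any using (here; there)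
open import Data.List.Relation.Unary.Unique.Propositional using (Unique)
open import Data.List.Relation.Binary.Permutation.Propositional
  using (_↭_; refl; prep; swap; trans; ↭-sym; ↭⇒↭ₛ)
open import Data.List.Relation.Binary.Permutation.Propositional.Properties
  using (∈-resp-↭; ++⁺ˡ; shift; shifts)
import Data.List.Relation.Binary.Permutation.Setoid.Properties as SetoidPermutation
open import Data.Product using (∃-syntax; _×_; _,_)
open import Data.Sum using (_⊎_; inj₁; inj₂)
open import Data.Empty using (⊥)
open import Relation.Binary.PropositionalEquality as ≡ using (_≡_; _≢_; cong; sym)
open import Relation.Nullary using (¬_)

open SetoidPermutation (≡.setoid ℕ) using (Unique-resp-↭)

data Zeck : ℕ → List ℕ → Set where
  nil  : ∀ {b} → Zeck b []
  cons : ∀ {b x xs} → b ≤ x → Zeck (suc (suc x)) xs → Zeck b (x ∷ xs)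

zeck-weaken : ∀ {b b′ l} → b′ ≤ b → Zeck b l → Zeck b′ l
zeck-weaken b′≤b nil         = nil
zeck-weaken b′≤b (cons b≤x z) = cons (≤-trans b′≤b b≤x) z

zeck-bound : ∀ {b l} → Zeck b l → All (b ≤_) l
zeck-bound nil          = []
zeck-bound (cons b≤x z) =
  b≤x ∷ zeck-bound (zeck-weaken (≤-trans b≤x (m≤n⇒m≤1+n (n≤1+n _))) z)

zeck-unique : ∀ {b l} → Zeck b l → Unique l
zeck-unique nil              = []
zeck-unique (cons {x = x} _ z) = All.map x≢ (zeck-bound z) ∷ zeck-unique z
  where
  x≢ : ∀ {y} → suc (suc x) ≤ y → x ≢ y
  x≢ x+2≤x ≡.refl = <-irrefl ≡.refl (≤-trans (n≤1+n _) x+2≤x)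

zeck-no-consecutive : ∀ {b l x} → Zeck b l → x ∈ l → suc x ∈ l → ⊥
zeck-no-consecutive (cons _ z) (here ≡.refl) (here ())
zeck-no-consecutive (cons _ z) (here ≡.refl) (there x+1∈) =
  <-irrefl ≡.refl (All.lookup (zeck-bound z) x+1∈)
zeck-no-consecutive (cons _ z) (there x∈) (here ≡.refl) =
  <-irrefl ≡.refl (≤-trans (m≤n⇒m≤1+n (n≤1+n _)) (All.lookup (zeck-bound z) x∈))
zeck-no-consecutive (cons _ z) (there x∈) (there x+1∈) =
  zeck-no-consecutive z x∈ x+1∈

zeck-no-repeat : ∀ {b l x rest} → Zeck b l → l ↭ x ∷ x ∷ rest → ⊥
zeck-no-repeat z l↭ with Unique-resp-↭ (↭⇒↭ₛ l↭) (zeck-unique z)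
... | (x≢x ∷ _) ∷ _ = x≢x ≡.refl

-- A state in Zeckendorf form is terminal: every move needs either a
-- repeated index or two consecutive ones.
zeck-terminal : ∀ {b l} → Zeck b l → Terminal l
zeck-terminal z _ (_ , _ , _ , combine j , l↭ , _) =
  zeck-no-consecutive z (∈-resp-↭ (↭-sym l↭) (here ≡.refl))
                        (∈-resp-↭ (↭-sym l↭) (there (here ≡.refl)))
zeck-terminal z _ (_ , _ , _ , split1   , l↭ , _) = zeck-no-repeat z l↭
zeck-terminal z _ (_ , _ , _ , split2   , l↭ , _) = zeck-no-repeat z l↭
zeck-terminal z _ (_ , _ , _ , splitN j , l↭ , _) = zeck-no-repeat z l↭

move : ∀ {removed added} rest → Move removed added →
       Step (removed ++ rest) (added ++ rest)
move {removed} {added} rest m = removed , added , rest , m , refl , refl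

_▷_ : ∀ {s t u k l} → Steps s t k → Steps t u l → Steps s u (k + l)
done     ▷ g′ = g′
step m g ▷ g′ = step m (g ▷ g′)

frame-step : ∀ R {s t} → Step s t → Step (R ++ s) (R ++ t)
frame-step R (removed , added , rest , m , s↭ , t↭) =
  removed , added , R ++ rest , m ,
  trans (++⁺ˡ R s↭) (shifts R removed) ,
  trans (++⁺ˡ R t↭) (shifts R added)

-- Hence a game played on part of a state is a game on the whole state;
-- this lets the remaining ones wait while the front of the state is played.
frame : ∀ R {s t k} → Steps s t k → Steps (R ++ s) (R ++ t) k
frame R done       = done
frame R (step m g) = step (frame-step R m) (frame R g)

replicate-++ : ∀ {A : Set} m p (x : A) →
               replicate m x ++ replicate p x ≡ replicate (p + m) x
replicate-++ zero    p x = cong (λ q → replicate q x) (sym (+-identityʳ p))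
replicate-++ (suc m) p x = begin
  x ∷ replicate m x ++ replicate p x ≡⟨ cong (x ∷_) (replicate-++ m p x) ⟩
  x ∷ replicate (p + m) x             ≡⟨ cong (λ q → replicate q x) (sym (+-suc p m)) ⟩
  replicate (p + suc m) x             ∎
  where open ≡.≡-Reasoning

ReachesZeck : ℕ → List ℕ → Set
ReachesZeck b s = ∃[ Z ] ∃[ k ] (Zeck b Z × Steps s Z k)

-- Carrying: adding F_{j+1} to a Zeckendorf list with entries ≥ j + 2 leads,
-- by moves F_i F_{i+1} ↦ F_{i+2}, to a Zeckendorf list with entries ≥ j + 1.
carry : ∀ j {ys} → Zeck (2 + j) ys → ReachesZeck (suc j) (suc j ∷ ys)
carry j nil = _ , 0 , cons ≤-refl nil , done
carry j (cons {xs = ys} j+2≤y z) with m≤n⇒m<n∨m≡n j+2≤y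
... | inj₁ j+2<y = _ , 0 , cons ≤-refl (cons j+2<y z) , done
... | inj₂ ≡.refl with carry (2 + j) z
...   | Z , k , zZ , g =
  Z , suc k , zeck-weaken (m≤n⇒m≤1+n (n≤1+n _)) zZ , step (move ys (combine j)) g

-- Adding one F₁ to a Zeckendorf list: merge it with a leading F₁ or F₂,
-- then carry.
insert-one : ∀ {Z} → Zeck 1 Z → ReachesZeck 1 (1 ∷ Z)
insert-one nil = _ , 0 , cons ≤-refl nil , done
insert-one (cons {x = 1} {xs = ys} _ z) with carry 1 z
... | Z , k , zZ , g = Z , suc k , zeck-weaken (s≤s z≤n) zZ , step (move ys split1) g
insert-one (cons {x = 2} {xs = ys} _ z) with carry 2 z
... | Z , k , zZ , g = Z , suc k , zeck-weaken (s≤s z≤n) zZ , step (move ys (combine 0)) g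
insert-one (cons {x = suc (suc (suc x))} _ z) =
  _ , 0 , cons ≤-refl (cons (s≤s (s≤s (s≤s z≤n))) z) , done

absorb-ones : ∀ r {Z} → Zeck 1 Z → ReachesZeck 1 (replicate r 1 ++ Z)
absorb-ones zero    z = _ , 0 , z , done
absorb-ones (suc r) z with absorb-ones r z
... | Z′ , k , z′ , g with insert-one z′
...   | Z″ , k′ , z″ , g′ = Z″ , k + k′ , z″ , frame (1 ∷ []) g ▷ g′

extend-opening : ∀ p m {Z} → Zeck 1 Z → ∃[ k ] (∀ {j} →
  Steps (replicate p 1) Z j → CompleteGameOfLength (p + m) (j + k))
extend-opening p m z with absorb-ones m z
... | Z′ , k , z′ , g = k , λ opening →
  Z′ , ≡.subst (λ s → Steps s Z′ _) (replicate-++ m p 1) (frame (replicate m 1) opening ▷ g) ,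
  zeck-terminal z′

one-three : List ℕ
one-three = 1 ∷ 3 ∷ []

one-three-zeck : Zeck 1 one-three
one-three-zeck = cons ≤-refl (cons (s≤s (s≤s (s≤s z≤n))) nil)

merge-last-ones : Step (replicate 4 1) (1 ∷ 1 ∷ 2 ∷ [])
merge-last-ones = _ , _ , 1 ∷ 1 ∷ [] , split1 , refl , shift 2 (1 ∷ 1 ∷ []) []

short-opening : Steps (replicate 4 1) one-three 2
short-opening =
  step merge-last-ones
    (step (_ , _ , 1 ∷ [] , combine 0 , prep 1 (swap 1 2 refl) , swap 1 3 refl) done)

long-opening : Steps (replicate 4 1) one-three 3
long-opening =
  step merge-last-ones (step (move (2 ∷ []) split1) (step (move [] split2) done))

consecutive-parity : ∀ k → (k % 2 ≡ 0 × suc k % 2 ≡ 1) ⊎ (k % 2 ≡ 1 × suc k % 2 ≡ 0)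
consecutive-parity zero          = inj₁ (≡.refl , ≡.refl)
consecutive-parity (suc zero)    = inj₂ (≡.refl , ≡.refl)
consecutive-parity (suc (suc k)) = consecutive-parity k

consecutive-lengths : ∀ {n k} → CompleteGameOfLength n k → CompleteGameOfLength n (suc k) →
    (∃[ k₁ ] ∃[ k₂ ] (CompleteGameOfLength n k₁ × CompleteGameOfLength n k₂ × ¬ (k₁ ≡ k₂)))
    × (∃[ k ] (CompleteGameOfLength n k × k % 2 ≡ 1))
    × (∃[ k ] (CompleteGameOfLength n k × k % 2 ≡ 0))
consecutive-lengths {k = k} short long with consecutive-parity k
... | inj₁ (even , odd) = (_ , _ , long , short , 1+n≢n) , (_ , long , odd) , (_ , short , even)
... | inj₂ (odd , even) = (_ , _ , long , short , 1+n≢n) , (_ , short , odd) , (_ , long , even)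

corollary2p4 : ∀ (n : ℕ) → 3 < n →
    (∃[ k₁ ] ∃[ k₂ ] (CompleteGameOfLength n k₁ × CompleteGameOfLength n k₂ × ¬ (k₁ ≡ k₂)))
    × (∃[ k ] (CompleteGameOfLength n k × k % 2 ≡ 1))
    × (∃[ k ] (CompleteGameOfLength n k × k % 2 ≡ 0))
corollary2p4 (suc (suc (suc (suc m)))) (s≤s (s≤s (s≤s (s≤s _)))) with extend-opening 4 m one-three-zeck
... | k , complete = consecutive-lengths (complete short-opening) (complete long-opening)
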